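{- Let $\rho$ be a monotone graph invariant and let $G$ be a nonempty graph with $\rho(G)=k$. Suppose $G$ contains $s$ nonempty subgraphs $G_1,\dots,G_s$ with $\rho(G_1)=\dots=\rho(G_s)=k$, let $a\geq 0$ be the number of vertices that occur in at least two of these subgraphs, and let $q\geq 1$ be the maximum number of these subgraphs having a common vertex. Then $vs_{\rho}(G)\geq \frac{1}{q}\sum_{i=1}^{s} vs_{\rho}(G_i)\geq \frac{s}{q}$ and $vs_{\rho}(G)\geq \sum_{i=1}^{s} vs_{\rho}(G_i)-a(q-1)$.
   Context: All graphs are finite and simple; a graph is empty if it has no edges. A graph invariant $\rho$ is monotone if it is monotone increasing ($H\subseteq G$ implies $\rho(H)\leq\rho(G)$) or monotone decreasing ($H\subseteq G$ implies $\rho(H)\geq\rho(G)$). For an invariant $\rho$, the $\rho$-vertex stability number $vs_{\rho}(G)$ is the minimum number of vertices of $G$ whose removal results in a graph $H\subseteq G$ with $\rho(H)\neq\rho(G)$ or with $E(H)=\emptyset$. -}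

module Defs where

open import Level using (Level; _⊔_)
open import Data.Bool using (Bool; true; false; _∧_; not; T)
open import Data.Bool.Properties using (∧-comm)
open import Data.Nat using (ℕ; zero; suc; _≤_; _≤ᵇ_) renaming (_⊔_ to _⊔ℕ_)
open import Data.Fin using (Fin)
open import Data.Fin.Subset using (Subset; ∣_∣)
open import Data.Vec using (Vec; lookup; tabulate; foldr)
open import Data.Vec.Properties using (lookup∘tabulate)
open import Data.Product using (Σ; ∃; ∃-syntax; _×_; _,_; proj₁; proj₂)
open import Data.Sum using (_⊎_)
open import Relation.Nullary using (¬_)
open import Relation.Binary.PropositionalEquality
  using (_≡_; refl; trans; cong; cong₂)
open import Relation.Binary.Bundles using (Poset)

-- A graph of "ambient size" n has vertex set V ⊆ Fin n (a Subset n) and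
-- a symmetric irreflexive adjacency relation on Fin n whose edges have
-- both ends in V.  Every finite simple graph is (isomorphic to) such a
-- graph, and subgraphs of a graph on ambient Fin n are again graphs on
-- the same ambient Fin n, with the same vertex names.

_∈V_ : {n : ℕ} → Fin n → Subset n → Set
v ∈V S = lookup S v ≡ true

record Graph (n : ℕ) : Set where
  field
    V      : Subset n
    adj    : Fin n → Fin n → Bool
    adjSym : ∀ u v → adj u v ≡ adj v u
    irrefl : ∀ v → adj v v ≡ false
    closed : ∀ u v → adj u v ≡ true → u ∈V V
open Graph public

-- (closed for the second endpoint follows from sym.)

_⊆G_ : {n : ℕ} → Graph n → Graph n → Set
H ⊆G G = (∀ v → v ∈V V H → v ∈V V G) × (∀ u v → adj H u v ≡ true → adj G u v ≡ true)

Empty : {n : ℕ} → Graph n → Set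
Empty G = ∀ u v → adj G u v ≡ false

Nonempty : {n : ℕ} → Graph n → Set
Nonempty G = ∃[ u ] ∃[ v ] adj G u v ≡ true

private
  ∧-true₁ : ∀ {a b : Bool} → (a ∧ b) ≡ true → a ≡ true
  ∧-true₁ {true} _ = refl

  ∧-true₂ : ∀ {a b : Bool} → (a ∧ b) ≡ true → b ≡ true
  ∧-true₂ {true} {true} _ = refl

  ∧-intro : ∀ {a b : Bool} → a ≡ true → b ≡ true → (a ∧ b) ≡ true
  ∧-intro refl refl = refl

_─_ : {n : ℕ} → Graph n → Subset n → Graph n
_─_ {n} G S = record
  { V      = tabulate (λ v → lookup (V G) v ∧ not (lookup S v))
  ; adj    = adj'
  ; adjSym = λ u v → cong₂ _∧_ (adjSym G u v) (∧-comm (not (lookup S u)) (not (lookup S v)))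
  ; irrefl = λ v → cong (_∧ _) (irrefl G v)
  ; closed = λ u v e → trans (lookup∘tabulate _ u)
               (∧-intro (closed G u v (∧-true₁ e)) (∧-true₁ (∧-true₂ {adj G u v} e)))
  }
  where
  adj' : Fin n → Fin n → Bool
  adj' u v = adj G u v ∧ (not (lookup S u) ∧ not (lookup S v))

record Iso {n m : ℕ} (G : Graph n) (H : Graph m) : Set where
  field
    f     : Fin n → Fin m
    g     : Fin m → Fin n
    f∈    : ∀ v → v ∈V V G → f v ∈V V H
    g∈    : ∀ w → w ∈V V H → g w ∈V V G
    gf    : ∀ v → v ∈V V G → g (f v) ≡ v
    fg    : ∀ w → w ∈V V H → f (g w) ≡ w
    adj≡  : ∀ u v → u ∈V V G → v ∈V V G → adj H (f u) (f v) ≡ adj G u v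

module _ {c ℓ₁ ℓ₂ : Level} (P : Poset c ℓ₁ ℓ₂) where
  open Poset P using (_≈_) renaming (Carrier to A; _≤_ to _≼_)

  Invariant : Set c
  Invariant = ∀ {n} → Graph n → A

  IsGraphInvariant : Invariant → Set ℓ₁
  IsGraphInvariant ρ = ∀ {n m} (G : Graph n) (H : Graph m) → Iso G H → ρ G ≈ ρ H

  MonotoneIncreasing MonotoneDecreasing Monotone : Invariant → Set ℓ₂
  MonotoneIncreasing ρ = ∀ {n} (H G : Graph n) → H ⊆G G → ρ H ≼ ρ G
  MonotoneDecreasing ρ = ∀ {n} (H G : Graph n) → H ⊆G G → ρ G ≼ ρ H
  Monotone ρ = MonotoneIncreasing ρ ⊎ MonotoneDecreasing ρ

  Destabilizing : Invariant → ∀ {n} → Graph n → Subset n → Set ℓ₁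
  Destabilizing ρ G S =
    (∀ v → v ∈V S → v ∈V V G) × ((¬ (ρ (G ─ S) ≈ ρ G)) ⊎ Empty (G ─ S))

  VS : Invariant → ∀ {n} → Graph n → ℕ → Set ℓ₁
  VS ρ G k = (∃[ S ] (Destabilizing ρ G S × ∣ S ∣ ≡ k))
           × (∀ S → Destabilizing ρ G S → k ≤ ∣ S ∣)

mult : {n s : ℕ} → (Fin s → Graph n) → Fin n → ℕ
mult Gs v = ∣ tabulate (λ i → lookup (V (Gs i)) v) ∣

overlapCount : {n s : ℕ} → (Fin s → Graph n) → ℕ
overlapCount Gs = ∣ tabulate (λ v → 2 ≤ᵇ mult Gs v) ∣

maxMult : {n s : ℕ} → (Fin s → Graph n) → ℕ
maxMult {n} Gs = foldr (λ _ → ℕ) _⊔ℕ_ 0 (tabulate (mult Gs))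

module Submission where

-- Fix a minimum destabilizing set S of G, so |S| = vs(G).
-- For every i, the trace T = S ∩ V(Gᵢ) destabilizes Gᵢ: since
-- Gᵢ - T ⊆ G - S ⊆ G, if ρ(Gᵢ - T) were ρ(Gᵢ) = ρ(G), monotonicity would
-- squeeze ρ(G - S) to ρ(G) as well; and an edge of Gᵢ - T would be an
-- edge of G - S.
-- Hence vs(Gᵢ) ≤ |S ∩ V(Gᵢ)|, and counting incidences
--   Σᵢ vs(Gᵢ) ≤ Σᵢ |S ∩ V(Gᵢ)| = Σ_{v ∈ S} mult(v),
-- where mult(v) ≤ q is the number of Gᵢ containing v.  Bounding mult(v) by q
-- gives Σᵢ vs(Gᵢ) ≤ q·vs(G); bounding it by 1 + [mult(v) ≥ 2]·(q - 1) gives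
-- Σᵢ vs(Gᵢ) ≤ vs(G) + a·(q - 1).  Finally s ≤ Σᵢ vs(Gᵢ) because removing
-- no vertices changes neither ρ nor the edge set of a nonempty graph.

open import Defs
open import Level using (Level)
open import Data.Nat using (ℕ; _≤_; _*_; _+_; _∸_)
open import Data.Fin using (Fin)
open import Data.Vec using (sum; tabulate)
open import Relation.Binary.Bundles using (Poset)
open import Data.Product using (_×_)

open import Data.Nat using (zero; suc; z≤n; s≤s; _≤ᵇ_) renaming (_⊔_ to _⊔ℕ_)
open import Data.Nat.Properties
open import Data.Bool using (Bool; true; false; _∧_; not)
open import Data.Bool.Properties using (∧-identityʳ; ¬-not)
open import Data.Fin using (zero; suc)
open import Data.Fin.Subset using (Subset; ∣_∣; _∩_)
open import Data.Vec using ([]; _∷_; lookup; foldr)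
open import Data.Vec.Properties using (lookup∘tabulate; lookup-zipWith)
open import Data.Product using (_,_; proj₂)
open import Data.Sum using (_⊎_; inj₁; inj₂)
open import Relation.Nullary using (¬_)
open import Relation.Binary.PropositionalEquality
open import Algebra.Properties.Semiring.Sum +-*-semiring
  using (sum-syntax; sum-cong-≗; ∑-comm; ∑-distrib-+; *-distribˡ-sum; *-distribʳ-sum)
  renaming (sum to ∑)

⟦_⟧ : Bool → ℕ
⟦ true ⟧ = 1
⟦ false ⟧ = 0

⟦∧⟧ : ∀ a b → ⟦ a ∧ b ⟧ ≡ ⟦ a ⟧ * ⟦ b ⟧
⟦∧⟧ true b = sym (*-identityˡ ⟦ b ⟧)
⟦∧⟧ false b = refl

sum-tabulate : ∀ {n} (f : Fin n → ℕ) → sum (tabulate f) ≡ ∑[ i < n ] f i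
sum-tabulate {zero} f = refl
sum-tabulate {suc n} f = cong (f zero +_) (sum-tabulate (λ i → f (suc i)))

∑-mono : ∀ {n} {f g : Fin n → ℕ} → (∀ i → f i ≤ g i) → ∑[ i < n ] f i ≤ ∑[ i < n ] g i
∑-mono {zero} f≤g = z≤n
∑-mono {suc n} f≤g = +-mono-≤ (f≤g zero) (∑-mono (λ i → f≤g (suc i)))

∑-positive : ∀ {n} {f : Fin n → ℕ} → (∀ i → 1 ≤ f i) → n ≤ ∑[ i < n ] f i
∑-positive {zero} pos = z≤n
∑-positive {suc n} pos = +-mono-≤ (pos zero) (∑-positive (λ i → pos (suc i)))

∣p∣≡∑ : ∀ {n} (p : Subset n) → ∣ p ∣ ≡ ∑[ v < n ] ⟦ lookup p v ⟧
∣p∣≡∑ [] = refl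
∣p∣≡∑ (true ∷ p) = cong suc (∣p∣≡∑ p)
∣p∣≡∑ (false ∷ p) = ∣p∣≡∑ p

∣tabulate∣≡∑ : ∀ {n} (b : Fin n → Bool) → ∣ tabulate b ∣ ≡ ∑[ v < n ] ⟦ b v ⟧
∣tabulate∣≡∑ b = trans (∣p∣≡∑ (tabulate b)) (sum-cong-≗ (λ v → cong ⟦_⟧ (lookup∘tabulate b v)))

∣p∣≡0⇒empty : ∀ {n} (p : Subset n) → ∣ p ∣ ≡ 0 → ∀ v → lookup p v ≡ false
∣p∣≡0⇒empty (false ∷ p) ∣p∣≡0 zero = refl
∣p∣≡0⇒empty (false ∷ p) ∣p∣≡0 (suc v) = ∣p∣≡0⇒empty p ∣p∣≡0 v

≤-foldr-⊔ : ∀ {n} (f : Fin n → ℕ) v → f v ≤ foldr (λ _ → ℕ) _⊔ℕ_ 0 (tabulate f)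
≤-foldr-⊔ f zero = m≤m⊔n (f zero) _
≤-foldr-⊔ f (suc v) = m≤n⇒m≤o⊔n (f zero) (≤-foldr-⊔ (λ w → f (suc w)) v)

-- Double counting: the sizes of the traces of S on the sets Tᵢ add up to
-- the number of pairs (v, i) with v ∈ S ∩ Tᵢ, i.e. to the sum over v ∈ S of
-- the number of Tᵢ containing v.
∑-∣∩∣ : ∀ {n s} (S : Subset n) (T : Fin s → Subset n) →
  ∑[ i < s ] ∣ S ∩ T i ∣ ≡ ∑[ v < n ] (⟦ lookup S v ⟧ * ∣ tabulate (λ i → lookup (T i) v) ∣)
∑-∣∩∣ {n} {s} S T = begin
  ∑[ i < s ] ∣ S ∩ T i ∣
    ≡⟨ sum-cong-≗ (λ i → trans (∣p∣≡∑ (S ∩ T i)) (sum-cong-≗ (λ v → indicator i v))) ⟩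
  ∑[ i < s ] ∑[ v < n ] (⟦ lookup S v ⟧ * ⟦ lookup (T i) v ⟧)
    ≡⟨ ∑-comm (λ i v → ⟦ lookup S v ⟧ * ⟦ lookup (T i) v ⟧) ⟩
  ∑[ v < n ] ∑[ i < s ] (⟦ lookup S v ⟧ * ⟦ lookup (T i) v ⟧)
    ≡⟨ sum-cong-≗ (λ v → sym (*-distribˡ-sum ⟦ lookup S v ⟧ (λ i → ⟦ lookup (T i) v ⟧))) ⟩
  ∑[ v < n ] (⟦ lookup S v ⟧ * ∑[ i < s ] ⟦ lookup (T i) v ⟧)
    ≡⟨ sum-cong-≗ (λ v → cong (⟦ lookup S v ⟧ *_) (sym (∣tabulate∣≡∑ (λ i → lookup (T i) v)))) ⟩
  ∑[ v < n ] (⟦ lookup S v ⟧ * ∣ tabulate (λ i → lookup (T i) v) ∣) ∎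
  where
  open ≡-Reasoning
  indicator : ∀ i v → ⟦ lookup (S ∩ T i) v ⟧ ≡ ⟦ lookup S v ⟧ * ⟦ lookup (T i) v ⟧
  indicator i v = trans (cong ⟦_⟧ (lookup-zipWith _∧_ v S (T i))) (⟦∧⟧ (lookup S v) (lookup (T i) v))

∑-weighted≤ : ∀ {n} (S : Subset n) (w : Fin n → ℕ) q → (∀ v → w v ≤ q) →
  ∑[ v < n ] (⟦ lookup S v ⟧ * w v) ≤ q * ∣ S ∣
∑-weighted≤ {n} S w q w≤q = begin
  ∑[ v < n ] (⟦ lookup S v ⟧ * w v) ≤⟨ ∑-mono (λ v → *-monoʳ-≤ ⟦ lookup S v ⟧ (w≤q v)) ⟩
  ∑[ v < n ] (⟦ lookup S v ⟧ * q)   ≡⟨ sym (*-distribʳ-sum q (λ v → ⟦ lookup S v ⟧)) ⟩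
  ∑[ v < n ] ⟦ lookup S v ⟧ * q     ≡⟨ cong (_* q) (sym (∣p∣≡∑ S)) ⟩
  ∣ S ∣ * q                         ≡⟨ *-comm ∣ S ∣ q ⟩
  q * ∣ S ∣ ∎
  where open ≤-Reasoning

≤1+excess : ∀ {q} k → k ≤ q → k ≤ 1 + ⟦ 2 ≤ᵇ k ⟧ * (q ∸ 1)
≤1+excess zero _ = z≤n
≤1+excess (suc zero) _ = s≤s z≤n
≤1+excess {q} (suc (suc k)) k≤q = begin
  suc (suc k)       ≤⟨ k≤q ⟩
  q                 ≡⟨ sym (m+[n∸m]≡n (≤-trans (s≤s z≤n) k≤q)) ⟩
  1 + (q ∸ 1)       ≡⟨ cong (1 +_) (sym (*-identityˡ (q ∸ 1))) ⟩
  1 + 1 * (q ∸ 1) ∎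
  where open ≤-Reasoning

∑-weighted≤∣S∣+excess : ∀ {n} (S : Subset n) (w : Fin n → ℕ) q → (∀ v → w v ≤ q) →
  ∑[ v < n ] (⟦ lookup S v ⟧ * w v) ≤ ∣ S ∣ + ∣ tabulate (λ v → 2 ≤ᵇ w v) ∣ * (q ∸ 1)
∑-weighted≤∣S∣+excess {n} S w q w≤q = begin
  ∑[ v < n ] (⟦ lookup S v ⟧ * w v)
    ≤⟨ ∑-mono pointwise ⟩
  ∑[ v < n ] (⟦ lookup S v ⟧ + ⟦ 2 ≤ᵇ w v ⟧ * (q ∸ 1))
    ≡⟨ ∑-distrib-+ (λ v → ⟦ lookup S v ⟧) (λ v → ⟦ 2 ≤ᵇ w v ⟧ * (q ∸ 1)) ⟩
  ∑[ v < n ] ⟦ lookup S v ⟧ + ∑[ v < n ] (⟦ 2 ≤ᵇ w v ⟧ * (q ∸ 1))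
    ≡⟨ cong₂ _+_ (sym (∣p∣≡∑ S)) (sym (*-distribʳ-sum (q ∸ 1) (λ v → ⟦ 2 ≤ᵇ w v ⟧))) ⟩
  ∣ S ∣ + ∑[ v < n ] ⟦ 2 ≤ᵇ w v ⟧ * (q ∸ 1)
    ≡⟨ cong (λ a → ∣ S ∣ + a * (q ∸ 1)) (sym (∣tabulate∣≡∑ (λ v → 2 ≤ᵇ w v))) ⟩
  ∣ S ∣ + ∣ tabulate (λ v → 2 ≤ᵇ w v) ∣ * (q ∸ 1) ∎
  where
  open ≤-Reasoning
  pointwise : ∀ v → ⟦ lookup S v ⟧ * w v ≤ ⟦ lookup S v ⟧ + ⟦ 2 ≤ᵇ w v ⟧ * (q ∸ 1)
  pointwise v with lookup S v
  ... | false = z≤n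
  ... | true = ≤-trans (≤-reflexive (+-identityʳ (w v))) (≤1+excess (w v) (w≤q v))

mult≤maxMult : ∀ {n s} (Gs : Fin s → Graph n) v → mult Gs v ≤ maxMult Gs
mult≤maxMult Gs = ≤-foldr-⊔ (mult Gs)

⊆G-trans : ∀ {n} {F H G : Graph n} → F ⊆G H → H ⊆G G → F ⊆G G
⊆G-trans (FV⊆HV , FE⊆HE) (HV⊆GV , HE⊆GE) =
  (λ v v∈F → HV⊆GV v (FV⊆HV v v∈F)) , (λ u v e → HE⊆GE u v (FE⊆HE u v e))

∧-true₁ : ∀ {a b : Bool} → a ∧ b ≡ true → a ≡ true
∧-true₁ {true} _ = refl

∧-true₂ : ∀ {a b : Bool} → a ∧ b ≡ true → b ≡ true
∧-true₂ {true} b≡true = b≡true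

∧-monoˡ : ∀ {a b : Bool} c → (a ≡ true → b ≡ true) → a ∧ c ≡ true → b ∧ c ≡ true
∧-monoˡ {true} c a⇒b a∧c rewrite a⇒b refl = a∧c

∈V─⁻ : ∀ {n} (G : Graph n) S v → v ∈V V (G ─ S) → lookup (V G) v ∧ not (lookup S v) ≡ true
∈V─⁻ G S v = trans (sym (lookup∘tabulate _ v))

∈V─⁺ : ∀ {n} (G : Graph n) S v → lookup (V G) v ∧ not (lookup S v) ≡ true → v ∈V V (G ─ S)
∈V─⁺ G S v = trans (lookup∘tabulate _ v)

─⊆ : ∀ {n} (G : Graph n) S → (G ─ S) ⊆G G
─⊆ G S = (λ v v∈ → ∧-true₁ (∈V─⁻ G S v v∈)) , (λ u v e → ∧-true₁ e)

─-mono : ∀ {n} {H G : Graph n} S → H ⊆G G → (H ─ S) ⊆G (G ─ S)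
─-mono {H = H} {G} S (HV⊆GV , HE⊆GE) =
    (λ v v∈ → ∈V─⁺ G S v (∧-monoˡ (not (lookup S v)) (HV⊆GV v) (∈V─⁻ H S v v∈)))
  , (λ u v e → ∧-monoˡ _ (HE⊆GE u v) e)

trace-on-V : ∀ {n} (H : Graph n) S v → v ∈V V H → lookup (S ∩ V H) v ≡ lookup S v
trace-on-V H S v v∈H = begin
  lookup (S ∩ V H) v          ≡⟨ lookup-zipWith _∧_ v S (V H) ⟩
  lookup S v ∧ lookup (V H) v ≡⟨ cong (lookup S v ∧_) v∈H ⟩
  lookup S v ∧ true           ≡⟨ ∧-identityʳ (lookup S v) ⟩
  lookup S v ∎
  where open ≡-Reasoning

─-trace : ∀ {n} (H : Graph n) S → (H ─ (S ∩ V H)) ⊆G (H ─ S)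
─-trace H S = vertex , edge
  where
  vertex : ∀ v → v ∈V V (H ─ (S ∩ V H)) → v ∈V V (H ─ S)
  vertex v v∈ = ∈V─⁺ H S v (subst (λ b → lookup (V H) v ∧ not b ≡ true)
                                  (trace-on-V H S v (∧-true₁ in-H∖T)) in-H∖T)
    where
    in-H∖T : lookup (V H) v ∧ not (lookup (S ∩ V H) v) ≡ true
    in-H∖T = ∈V─⁻ H (S ∩ V H) v v∈

  edge : ∀ u v → adj (H ─ (S ∩ V H)) u v ≡ true → adj (H ─ S) u v ≡ true
  edge u v e = trans (sym (cong₂ (λ a b → adj H u v ∧ (not a ∧ not b))
                                 (trace-on-V H S u u∈H) (trace-on-V H S v v∈H))) e
    where
    uv : adj H u v ≡ true
    uv = ∧-true₁ e
    u∈H : u ∈V V H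
    u∈H = closed H u v uv
    v∈H : v ∈V V H
    v∈H = closed H v u (trans (adjSym H v u) uv)

─-nothing : ∀ {n} (G : Graph n) S → (∀ v → lookup S v ≡ false) → G ⊆G (G ─ S)
─-nothing G S S-empty =
    (λ v v∈G → ∈V─⁺ G S v (begin
       lookup (V G) v ∧ not (lookup S v) ≡⟨ cong₂ (λ a b → a ∧ not b) v∈G (S-empty v) ⟩
       true ∎))
  , (λ u v e → begin
       adj G u v ∧ (not (lookup S u) ∧ not (lookup S v))
         ≡⟨ cong₂ (λ a b → adj G u v ∧ (not a ∧ not b)) (S-empty u) (S-empty v) ⟩
       adj G u v ∧ true ≡⟨ ∧-identityʳ (adj G u v) ⟩
       adj G u v        ≡⟨ e ⟩
       true ∎)
  where open ≡-Reasoning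

module Stability {c ℓ₁ ℓ₂ : Level} (P : Poset c ℓ₁ ℓ₂) (ρ : Invariant P)
                 (mono : Monotone P ρ) where
  open Poset P using (_≈_; antisym; reflexive; module Eq) renaming (trans to ≼-trans)

  squeezed : ∀ {n} {F H G : Graph n} → F ⊆G H → H ⊆G G → ρ F ≈ ρ G → ρ H ≈ ρ G
  squeezed {F = F} {H} {G} F⊆H H⊆G ρF≈ρG = by-direction mono
    where
    by-direction : Monotone P ρ → ρ H ≈ ρ G
    by-direction (inj₁ increasing) = antisym (increasing H G H⊆G)
      (≼-trans (reflexive (Eq.sym ρF≈ρG)) (increasing F H F⊆H))
    by-direction (inj₂ decreasing) = antisym
      (≼-trans (decreasing F H F⊆H) (reflexive ρF≈ρG)) (decreasing H G H⊆G)

  trace-destabilizing : ∀ {n} {H G : Graph n} S → H ⊆G G → ρ H ≈ ρ G →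
    Destabilizing P ρ G S → Destabilizing P ρ H (S ∩ V H)
  trace-destabilizing {H = H} {G} S H⊆G ρH≈ρG (_ , changes) =
    trace⊆V , transfer changes
    where
    H─T⊆G─S : (H ─ (S ∩ V H)) ⊆G (G ─ S)
    H─T⊆G─S = ⊆G-trans {F = H ─ (S ∩ V H)} {H ─ S} {G ─ S} (─-trace H S) (─-mono {H = H} {G} S H⊆G)

    trace⊆V : ∀ v → v ∈V (S ∩ V H) → v ∈V V H
    trace⊆V v v∈ = ∧-true₂ (trans (sym (lookup-zipWith _∧_ v S (V H))) v∈)

    transfer : (¬ (ρ (G ─ S) ≈ ρ G)) ⊎ Empty (G ─ S) →
               (¬ (ρ (H ─ (S ∩ V H)) ≈ ρ H)) ⊎ Empty (H ─ (S ∩ V H))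
    transfer (inj₁ ρ-changes) = inj₁ (λ ρH─T≈ρH →
      ρ-changes (squeezed H─T⊆G─S (─⊆ G S) (Eq.trans ρH─T≈ρH ρH≈ρG)))
    transfer (inj₂ no-edges) = inj₂ (λ u v → ¬-not (λ e →
      true≢false (trans (sym (proj₂ H─T⊆G─S u v e)) (no-edges u v))))
      where
      true≢false : true ≢ false
      true≢false ()

  destabilizing-nonempty : ∀ {n} {G : Graph n} S → Nonempty G →
    Destabilizing P ρ G S → 1 ≤ ∣ S ∣
  destabilizing-nonempty {G = G} S (u , v , uv) (_ , changes) =
    n≢0⇒n>0 (λ ∣S∣≡0 → unchanged (─-nothing G S (∣p∣≡0⇒empty S ∣S∣≡0)) changes)
    where
    unchanged : G ⊆G (G ─ S) → ¬ ((¬ (ρ (G ─ S) ≈ ρ G)) ⊎ Empty (G ─ S))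
    unchanged G⊆G─S (inj₁ ρ-changes) = ρ-changes (squeezed G⊆G─S (─⊆ G S) Eq.refl)
    unchanged G⊆G─S (inj₂ no-edges) with trans (sym (no-edges u v)) (proj₂ G⊆G─S u v uv)
    ... | ()

  vs≤trace : ∀ {n} {H G : Graph n} S y → H ⊆G G → ρ H ≈ ρ G →
    Destabilizing P ρ G S → VS P ρ H y → y ≤ ∣ S ∩ V H ∣
  vs≤trace {H = H} S y H⊆G ρH≈ρG S-destab (_ , minimal) =
    minimal (S ∩ V H) (trace-destabilizing S H⊆G ρH≈ρG S-destab)

  vs-positive : ∀ {n} {G : Graph n} y → Nonempty G → VS P ρ G y → 1 ≤ y
  vs-positive y G-nonempty ((S , S-destab , refl) , _) =
    destabilizing-nonempty S G-nonempty S-destab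

  ∑vs≤∑mult : ∀ {n s} {G : Graph n} (Gs : Fin s → Graph n) S →
    (∀ i → Gs i ⊆G G) → (∀ i → ρ (Gs i) ≈ ρ G) → Destabilizing P ρ G S →
    (y : Fin s → ℕ) → (∀ i → VS P ρ (Gs i) (y i)) →
    sum (tabulate y) ≤ ∑[ v < n ] (⟦ lookup S v ⟧ * mult Gs v)
  ∑vs≤∑mult {n} {s} Gs S Gs⊆G ρGs≈ρG S-destab y y-vs = begin
    sum (tabulate y)                 ≡⟨ sum-tabulate y ⟩
    ∑[ i < s ] y i                   ≤⟨ ∑-mono (λ i → vs≤trace S (y i) (Gs⊆G i) (ρGs≈ρG i) S-destab (y-vs i)) ⟩
    ∑[ i < s ] ∣ S ∩ V (Gs i) ∣      ≡⟨ ∑-∣∩∣ S (λ i → V (Gs i)) ⟩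
    ∑[ v < n ] (⟦ lookup S v ⟧ * mult Gs v) ∎
    where open ≤-Reasoning

mainTheorem2 : {c ℓ₁ ℓ₂ : Level} (P : Poset c ℓ₁ ℓ₂) (ρ : Invariant P)
    → IsGraphInvariant P ρ → Monotone P ρ
    → {n : ℕ} (G : Graph n) → Nonempty G
    → (s : ℕ) (Gs : Fin s → Graph n)
    → (∀ i → Gs i ⊆G G) → (∀ i → Nonempty (Gs i))
    → (∀ i → Poset._≈_ P (ρ (Gs i)) (ρ G))
    → 1 ≤ maxMult Gs
    → (x : ℕ) → VS P ρ G x
    → (y : Fin s → ℕ) → (∀ i → VS P ρ (Gs i) (y i))
    → (sum (tabulate y) ≤ maxMult Gs * x)
      × (s ≤ sum (tabulate y))
      × (sum (tabulate y) ≤ x + overlapCount Gs * (maxMult Gs ∸ 1))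
mainTheorem2 P ρ _ mono G _ s Gs Gs⊆G Gs-nonempty ρGs≈ρG _
             .(∣ S ∣) ((S , S-destab , refl) , _) y y-vs =
    ≤-trans ∑vs≤incidences (∑-weighted≤ S (mult Gs) (maxMult Gs) (mult≤maxMult Gs))
  , ≤-trans (∑-positive (λ i → vs-positive (y i) (Gs-nonempty i) (y-vs i)))
            (≤-reflexive (sym (sum-tabulate y)))
  , ≤-trans ∑vs≤incidences (∑-weighted≤∣S∣+excess S (mult Gs) (maxMult Gs) (mult≤maxMult Gs))
  where
  open Stability P ρ mono
  ∑vs≤incidences : sum (tabulate y) ≤ ∑[ v < _ ] (⟦ lookup S v ⟧ * mult Gs v)
  ∑vs≤incidences = ∑vs≤∑mult Gs S Gs⊆G ρGs≈ρG S-destab y y-vs
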